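{- Let $l\ge 1$ be an integer. The probability that $l$ independently and uniformly chosen random elements of $\mathcal{S}_n$ generate a transitive but imprimitive subgroup of $\mathcal{S}_n$ is less than $n\,2^{ -n(l-1)/4}$.
   Context: A transitive permutation group on $\{1,\dots,n\}$ is imprimitive if it preserves a partition of $\{1,\dots,n\}$ into blocks other than the partition into singletons and the partition with one block. -}

module Defs where

open import Data.Nat using (ℕ)
open import Data.Fin using (Fin)
open import Data.Fin.Permutation using (Permutation′; _⟨$⟩ʳ_; _⟨$⟩ˡ_)
open import Data.Bool using (Bool; true; false)
open import Data.List using (List; []; _∷_)
open import Data.Product using (_×_; _,_; ∃-syntax; Σ-syntax)
open import Relation.Binary.PropositionalEquality using (_≡_; _≢_)
open import Relation.Nullary using (¬_)

Tuple : ℕ → ℕ → Set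
Tuple l n = Fin l → Permutation′ n

-- Words in the generators and their inverses: (i , true) = σ_i, (i , false) = σ_i⁻¹.
Word : ℕ → Set
Word l = List (Fin l × Bool)

act : ∀ {l n} → Tuple l n → Word l → Fin n → Fin n
act σ [] x = x
act σ ((i , true) ∷ w) x = σ i ⟨$⟩ʳ act σ w x
act σ ((i , false) ∷ w) x = σ i ⟨$⟩ˡ act σ w x

IsTransitive : ∀ {l n} → Tuple l n → Set
IsTransitive {l} σ = ∀ x y → ∃[ w ] act {l} σ w x ≡ y

-- A partition of Fin n is given by a block-labelling f : Fin n → Fin n
-- (x, y in the same block iff f x ≡ f y).
Preserves : ∀ {l n} → Tuple l n → (Fin n → Fin n) → Set
Preserves {l} σ f = ∀ (w : Word l) x y → f x ≡ f y → f (act σ w x) ≡ f (act σ w y)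

Nontrivial : ∀ {n} → (Fin n → Fin n) → Set
Nontrivial f = (∃[ x ] ∃[ y ] (x ≢ y × f x ≡ f y)) × (∃[ x ] ∃[ y ] (f x ≢ f y))

IsImprimitive : ∀ {l n} → Tuple l n → Set
IsImprimitive {n = n} σ = IsTransitive σ × (Σ[ f ∈ (Fin n → Fin n) ] (Preserves σ f × Nontrivial f))

TransImprim : ∀ {l n} → Tuple l n → Set
TransImprim σ = IsTransitive σ × IsImprimitive σ

Distinct : ∀ {l n} → Tuple l n → Tuple l n → Set
Distinct σ τ = ¬ (∀ i x → σ i ⟨$⟩ʳ x ≡ τ i ⟨$⟩ʳ x)

{-# OPTIONS --safe #-}
module Submission where

-- Let σ₁,…,σₗ generate a transitive group preserving a nontrivial partition f. Transitivity
-- gives all blocks one size a, and nontriviality gives n = a·b with a, b ≥ 2. Enumerate Fin n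
-- block by block (blocks ordered by their least elements) and record each σᵢ by the sequence
-- of images of this enumeration, coding each value by its rank among the values still
-- available. For σ₁ every unused value is available: n! codes. For the later generators a
-- value in the middle of a block must lie in the image block of the block's first element:
-- |Sₐ ≀ S_b| = (a!)ᵇ·b! codes. The image sequence of σ₁ lists the blocks of f one after the
-- other, so it determines f, hence the enumeration, hence the whole tuple. Finally
-- |Sₐ ≀ S_b|⁴·2ⁿ ≤ (n!)⁴, because outside the last block every non-initial position of a block
-- has at most half as many choices as in Sₙ; and there are fewer than n block sizes.

open import Data.Bool using (true; false)
open import Data.Empty using (⊥-elim)
open import Data.Fin as Fin using (Fin; toℕ; fromℕ<) renaming (zero to fzero; suc to fsuc)
import Data.Fin.Properties as Fin
open import Data.Fin.Permutation using (Permutation′; _⟨$⟩ʳ_; _⟨$⟩ˡ_; inverseˡ; inverseʳ)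
open import Data.Fin.Subset using (Subset; inside; outside; _∈_; ∣_∣; ⊤; ⁅_⁆; ∁; _∩_)
open import Data.Fin.Subset.Properties
  using ( ∈⊤; ∣⊤∣≡n; x∈⁅x⁆; x∈⁅y⁆⇒x≡y; x≢y⇒x∉⁅y⁆; ∣⁅x⁆∣≡1; x∈p⇒x∉∁p; x∉p⇒x∈∁p
        ; p∩q⊆p; x∈p∩q⁺; x∈p∩q⁻; ∩-assoc; ∩-identityˡ; ∣p∩q∣≤∣p∣; ∣p∩q∣≤∣q∣; p⊂q⇒∣p∣<∣q∣)
open import Data.List as List using (List; length)
open import Data.List.Membership.Propositional.Properties using (∈-lookup)
open import Data.List.Relation.Unary.All as All using (All)
open import Data.List.Relation.Unary.AllPairs as AllPairs using (AllPairs)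
open import Data.Nat as ℕ
  using (ℕ; zero; suc; _+_; _*_; _∸_; _^_; _!; _≤_; _<_; _⊔_; z≤n; s≤s; NonZero; >-nonZero)
open import Data.Nat.DivMod
  using (_%_; _/_; m≡m%n+[m/n]*n; m%n<n; [m+kn]%n≡m%n; m<n⇒m%n≡m; m<n*o⇒m/o<n; m*n/n≡m; /-monoˡ-≤)
open import Data.Nat.Divisibility using (_∣_; divides; _∣?_)
open import Data.Nat.Properties
open import Algebra.Properties.CommutativeSemigroup *-commutativeSemigroup using (interchange; xy∙z≈y∙xz)
open import Data.Nat.Tactic.RingSolver using (solve-∀)
open import Data.Product using (∃; _×_; _,_; proj₁; proj₂)
open import Data.Sum using (inj₁; inj₂)
open import Data.Vec using (_∷_; here; there; tabulate)
open import Data.Vec.Properties using (lookup∘tabulate; []=⇒lookup; lookup⇒[]=; tabulate-cong)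
open import Function using (_∘_; _⇔_; mk⇔; Equivalence)
open import Function.Definitions using (Injective)
import Function.Properties.Equivalence as ⇔
open import Relation.Binary.Definitions using (tri<; tri≈; tri>)
open import Relation.Binary.PropositionalEquality
open import Relation.Nullary using (¬_; does; yes; no)
open import Relation.Nullary.Decidable using (dec-true; does-⇔)
open import Relation.Unary using (Pred; Decidable)

open import Defs

private variable
  m n : ℕ

injective-bounded⇒≤ : ∀ {B} (c : Fin m → ℕ) → (∀ i → c i < B) → (∀ {i j} → c i ≡ c j → i ≡ j) → m ≤ B
injective-bounded⇒≤ c c<B c-injective = Fin.injective⇒≤ {f = λ i → fromℕ< (c<B i)}
  (λ e → c-injective (Fin.fromℕ<-injective _ _ (c<B _) (c<B _) e))

module _ {ℓ} {P : Pred (Fin n) ℓ} (P? : Decidable P) where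

  ⟦_⟧ : Subset n
  ⟦_⟧ = tabulate (does ∘ P?)

  ∈⟦⟧⁺ : ∀ {x} → P x → x ∈ ⟦_⟧
  ∈⟦⟧⁺ {x} px = lookup⇒[]= x _ (trans (lookup∘tabulate _ x) (dec-true (P? x) px))

  ∈⟦⟧⁻ : ∀ {x} → x ∈ ⟦_⟧ → P x
  ∈⟦⟧⁻ {x} x∈ with P? x | trans (sym (lookup∘tabulate (does ∘ P?) x)) ([]=⇒lookup x∈)
  ... | yes px | _ = px

rank : Subset n → Fin n → ℕ
rank (_       ∷ p) fzero    = 0
rank (inside  ∷ p) (fsuc x) = suc (rank p x)
rank (outside ∷ p) (fsuc x) = rank p x

IsLeast : Subset n → Fin n → Set
IsLeast p x = x ∈ p × rank p x ≡ 0

rank-< : ∀ {p : Subset n} {x} → x ∈ p → rank p x < ∣ p ∣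
rank-< here                          = s≤s z≤n
rank-< {p = inside  ∷ p} (there x∈p) = s≤s (rank-< x∈p)
rank-< {p = outside ∷ p} (there x∈p) = rank-< x∈p

rank-injective : ∀ {p : Subset n} {x y} → x ∈ p → y ∈ p → rank p x ≡ rank p y → x ≡ y
rank-injective                   here        here        _  = refl
rank-injective {p = inside  ∷ p} here        (there _)   ()
rank-injective {p = inside  ∷ p} (there _)   here        ()
rank-injective {p = inside  ∷ p} (there x∈p) (there y∈p) e  = cong fsuc (rank-injective x∈p y∈p (suc-injective e))
rank-injective {p = outside ∷ p} (there x∈p) (there y∈p) e  = cong fsuc (rank-injective x∈p y∈p e)

rank-surjective : ∀ (p : Subset n) {j} → j < ∣ p ∣ → ∃ λ x → x ∈ p × rank p x ≡ j
rank-surjective (inside ∷ p) {zero}  _            = fzero , here , refl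
rank-surjective (inside ∷ p) {suc j} (s≤s j<∣p∣) =
  let x , x∈p , rx≡j = rank-surjective p j<∣p∣ in fsuc x , there x∈p , cong suc rx≡j
rank-surjective (outside ∷ p) j<∣p∣ =
  let x , x∈p , rx≡j = rank-surjective p j<∣p∣ in fsuc x , there x∈p , rx≡j

least-unique : ∀ {p : Subset n} {x y} → IsLeast p x → IsLeast p y → x ≡ y
least-unique (x∈p , rx≡0) (y∈p , ry≡0) = rank-injective x∈p y∈p (trans rx≡0 (sym ry≡0))

∣p∣≤∣q∣-by-injection : ∀ {p q : Subset n} (φ : Fin n → Fin n) → Injective _≡_ _≡_ φ →
                       (∀ {x} → x ∈ p → φ x ∈ q) → ∣ p ∣ ≤ ∣ q ∣
∣p∣≤∣q∣-by-injection {p = p} {q} φ φ-injective φ[p]⊆q = injective-bounded⇒≤ code code-< code-injective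
  where
  element : Fin ∣ p ∣ → Fin _
  element i = proj₁ (rank-surjective p (Fin.toℕ<n i))
  element-∈ : ∀ i → element i ∈ p
  element-∈ i = proj₁ (proj₂ (rank-surjective p (Fin.toℕ<n i)))
  element-rank : ∀ i → rank p (element i) ≡ toℕ i
  element-rank i = proj₂ (proj₂ (rank-surjective p (Fin.toℕ<n i)))

  code : Fin ∣ p ∣ → ℕ
  code i = rank q (φ (element i))
  code-< : ∀ i → code i < ∣ q ∣
  code-< i = rank-< (φ[p]⊆q (element-∈ i))
  code-injective : ∀ {i j} → code i ≡ code j → i ≡ j
  code-injective {i} {j} e = Fin.toℕ-injective (begin
    toℕ i              ≡⟨ element-rank i ⟨
    rank p (element i) ≡⟨ cong (rank p) (φ-injective φ[element]-equal) ⟩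
    rank p (element j) ≡⟨ element-rank j ⟩
    toℕ j              ∎)
    where
    open ≡-Reasoning
    φ[element]-equal = rank-injective (φ[p]⊆q (element-∈ i)) (φ[p]⊆q (element-∈ j)) e

x∈p⇒∣p∩∁⁅x⁆∣<∣p∣ : ∀ {p : Subset n} {x} → x ∈ p → ∣ p ∩ ∁ ⁅ x ⁆ ∣ < ∣ p ∣
x∈p⇒∣p∩∁⁅x⁆∣<∣p∣ {p = p} {x} x∈p =
  p⊂q⇒∣p∣<∣q∣ (p∩q⊆p p _ , x , x∈p , λ x∈ → x∈p⇒x∉∁p (x∈⁅x⁆ x) (proj₂ (x∈p∩q⁻ p _ x∈)))

∏< : (ℕ → ℕ) → ℕ → ℕ
∏< c zero    = 1
∏< c (suc m) = c m * ∏< c m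

∏<-+ : ∀ c s t → ∏< c (s + t) ≡ ∏< (λ j → c (s + j)) t * ∏< c s
∏<-+ c s zero    = trans (cong (∏< c) (+-identityʳ s)) (sym (+-identityʳ _))
∏<-+ c s (suc t) = begin
  ∏< c (s + suc t)                               ≡⟨ cong (∏< c) (+-suc s t) ⟩
  c (s + t) * ∏< c (s + t)                       ≡⟨ cong (c (s + t) *_) (∏<-+ c s t) ⟩
  c (s + t) * (∏< (λ j → c (s + j)) t * ∏< c s)  ≡⟨ *-assoc (c (s + t)) _ _ ⟨
  ∏< (λ j → c (s + j)) (suc t) * ∏< c s          ∎
  where open ≡-Reasoning

∏<-* : ∀ c d m → ∏< (λ j → c j * d j) m ≡ ∏< c m * ∏< d m
∏<-* c d zero    = refl
∏<-* c d (suc m) = trans (cong (c m * d m *_) (∏<-* c d m)) (interchange (c m) (d m) (∏< c m) (∏< d m))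

∏<-mono-≤ : ∀ {c d} m → (∀ j → j < m → c j ≤ d j) → ∏< c m ≤ ∏< d m
∏<-mono-≤ zero    _   = ≤-refl
∏<-mono-≤ (suc m) c≤d = *-mono-≤ (c≤d m ≤-refl) (∏<-mono-≤ m (λ j j<m → c≤d j (m<n⇒m<1+n j<m)))

∏<-factorial : ∀ N → ∏< (N ∸_) N ≡ N !
∏<-factorial zero    = refl
∏<-factorial (suc N) = begin
  ∏< (suc N ∸_) (1 + N)      ≡⟨ ∏<-+ (suc N ∸_) 1 N ⟩
  ∏< (N ∸_) N * (suc N * 1)  ≡⟨ cong₂ _*_ (∏<-factorial N) (*-identityʳ (suc N)) ⟩
  N ! * suc N                ≡⟨ *-comm (N !) (suc N) ⟩
  suc N !                    ∎
  where open ≡-Reasoning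

^-distribʳ-* : ∀ x y m → (x * y) ^ m ≡ x ^ m * y ^ m
^-distribʳ-* x y zero    = refl
^-distribʳ-* x y (suc m) = trans (cong (x * y *_) (^-distribʳ-* x y m)) (interchange x y (x ^ m) (y ^ m))

+*-< : ∀ {x d c P} → x < P → d < c → x + d * P < c * P
+*-< {x} {d} {c} {P} x<P d<c = begin-strict
  x + d * P  <⟨ +-monoˡ-< (d * P) x<P ⟩
  suc d * P  ≤⟨ *-monoˡ-≤ P d<c ⟩
  c * P      ∎
  where open ≤-Reasoning

+*-injective : ∀ {x x′ d d′ P} → x < P → x′ < P → x + d * P ≡ x′ + d′ * P → x ≡ x′ × d ≡ d′
+*-injective {x} {x′} {d} {d′} {P} x<P x′<P e with <-cmp d d′
... | tri≈ _ refl _ = +-cancelʳ-≡ (d * P) x x′ e , refl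
... | tri< d<d′ _ _ = ⊥-elim (<-irrefl e (<-≤-trans (+*-< x<P d<d′) (m≤n+m (d′ * P) x′)))
... | tri> _ _ d′<d = ⊥-elim (<-irrefl (sym e) (<-≤-trans (+*-< x′<P d′<d) (m≤n+m (d * P) x)))

radix : (ℕ → ℕ) → (ℕ → ℕ) → ℕ → ℕ
radix c d zero    = 0
radix c d (suc m) = radix c d m + d m * ∏< c m

radix-< : ∀ {c d} m → (∀ k → k < m → d k < c k) → radix c d m < ∏< c m
radix-< zero    _   = s≤s z≤n
radix-< (suc m) d<c = +*-< (radix-< m (λ k k<m → d<c k (m<n⇒m<1+n k<m))) (d<c m ≤-refl)

radix-injective : ∀ {c d d′} m → (∀ k → k < m → d k < c k) → (∀ k → k < m → d′ k < c k) →
                  radix c d m ≡ radix c d′ m → ∀ k → k < m → d k ≡ d′ k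
radix-injective {d = d} {d′} (suc m) d<c d′<c e k k<1+m
  with +*-injective {d = d m} {d′ m} (radix-< m (λ j j<m → d<c j (m<n⇒m<1+n j<m)))
                                     (radix-< m (λ j j<m → d′<c j (m<n⇒m<1+n j<m))) e
... | e′ , dm≡d′m with m≤n⇒m<n∨m≡n (≤-pred k<1+m)
...   | inj₁ k<m  = radix-injective m (λ j j<m → d<c j (m<n⇒m<1+n j<m))
                                      (λ j j<m → d′<c j (m<n⇒m<1+n j<m)) e′ k k<m
...   | inj₂ refl = dm≡d′m

radixᶠ : ℕ → (Fin m → ℕ) → ℕ
radixᶠ {zero}  Q d = 0
radixᶠ {suc m} Q d = d fzero + radixᶠ Q (d ∘ fsuc) * Q

radixᶠ-< : ∀ {Q} (d : Fin m → ℕ) → (∀ i → d i < Q) → radixᶠ Q d < Q ^ m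
radixᶠ-< {zero}      d d<Q = s≤s z≤n
radixᶠ-< {suc m} {Q} d d<Q =
  subst (radixᶠ Q d <_) (*-comm (Q ^ m) Q) (+*-< (d<Q fzero) (radixᶠ-< (d ∘ fsuc) (d<Q ∘ fsuc)))

radixᶠ-injective : ∀ {Q} (d d′ : Fin m → ℕ) → (∀ i → d i < Q) → (∀ i → d′ i < Q) →
                   radixᶠ Q d ≡ radixᶠ Q d′ → ∀ i → d i ≡ d′ i
radixᶠ-injective {suc m} {Q} d d′ d<Q d′<Q e = λ where
    fzero    → proj₁ split
    (fsuc i) → radixᶠ-injective (d ∘ fsuc) (d′ ∘ fsuc) (d<Q ∘ fsuc) (d′<Q ∘ fsuc) (proj₂ split) i
  where
  split = +*-injective {d = radixᶠ Q (d ∘ fsuc)} {radixᶠ Q (d′ ∘ fsuc)} (d<Q fzero) (d′<Q fzero) e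

max< : (ℕ → ℕ) → ℕ → ℕ
max< h zero    = 0
max< h (suc m) = h m ⊔ max< h m

≤max< : ∀ h {a m} → a < m → h a ≤ max< h m
≤max< h {a} {suc m} a<1+m with m≤n⇒m<n∨m≡n (≤-pred a<1+m)
... | inj₁ a<m  = m≤n⇒m≤o⊔n (h m) (≤max< h a<m)
... | inj₂ refl = m≤m⊔n (h a) (max< h a)

max<-preserves : ∀ {ℓ} (P : ℕ → Set ℓ) h m → P 0 → (∀ a → a < m → P (h a)) → P (max< h m)
max<-preserves P h zero    P0 _  = P0
max<-preserves P h (suc m) P0 Ph with ⊔-sel (h m) (max< h m)
... | inj₁ e = subst P (sym e) (Ph m ≤-refl)
... | inj₂ e = subst P (sym e) (max<-preserves P h m P0 (λ a a<m → Ph a (m<n⇒m<1+n a<m)))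

-- Coding injective sequences by successive choices

-- A rule gives the values allowed at step k; it may look at the values chosen before step k.
Rule : ℕ → Set
Rule n = (ℕ → Fin n) → ℕ → Subset n

unused : (ℕ → Fin n) → ℕ → Subset n
unused g zero    = ⊤
unused g (suc k) = unused g k ∩ ∁ ⁅ g k ⁆

options : Rule n → (ℕ → Fin n) → ℕ → Subset n
options R g k = R g k ∩ unused g k

Follows : Rule n → (ℕ → Fin n) → ℕ → Set
Follows R g m = ∀ k → k < m → g k ∈ options R g k

seqCode : Rule n → (ℕ → ℕ) → (ℕ → Fin n) → ℕ → ℕ
seqCode R c g = radix c (λ k → rank (options R g k) (g k))

∈unused⁺ : ∀ {g : ℕ → Fin n} {y} k → (∀ j → j < k → g j ≢ y) → y ∈ unused g k
∈unused⁺ zero    _   = ∈⊤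
∈unused⁺ (suc k) g≢y = x∈p∩q⁺ ( ∈unused⁺ k (λ j j<k → g≢y j (m<n⇒m<1+n j<k))
                              , x∉p⇒x∈∁p (x≢y⇒x∉⁅y⁆ (≢-sym (g≢y k ≤-refl))))

unused-cong : ∀ {g g′ : ℕ → Fin n} k → (∀ j → j < k → g j ≡ g′ j) → unused g k ≡ unused g′ k
unused-cong zero    _    = refl
unused-cong (suc k) g≡g′ =
  cong₂ (λ p y → p ∩ ∁ ⁅ y ⁆) (unused-cong k (λ j j<k → g≡g′ j (m<n⇒m<1+n j<k))) (g≡g′ k ≤-refl)

∣∩unused∣-shrinks : ∀ {g : ℕ → Fin n} (P : Subset n) t d →
                    (∀ j → t ≤ j → j < t + d → g j ∈ P ∩ unused g j) →
                    ∣ P ∩ unused g (t + d) ∣ + d ≤ ∣ P ∩ unused g t ∣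
∣∩unused∣-shrinks {g = g} P t zero _ =
  ≤-reflexive (trans (+-identityʳ _) (cong (λ s → ∣ P ∩ unused g s ∣) (+-identityʳ t)))
∣∩unused∣-shrinks {g = g} P t (suc d) g∈ = begin
  ∣ P ∩ unused g (t + suc d) ∣ + suc d           ≡⟨ cong (λ s → ∣ P ∩ unused g s ∣ + suc d) (+-suc t d) ⟩
  ∣ P ∩ (unused g (t + d) ∩ ∁ ⁅ y ⁆) ∣ + suc d   ≡⟨ cong (λ q → ∣ q ∣ + suc d) (∩-assoc P _ _) ⟨
  ∣ (P ∩ unused g (t + d)) ∩ ∁ ⁅ y ⁆ ∣ + suc d   ≡⟨ +-suc _ d ⟩
  suc ∣ (P ∩ unused g (t + d)) ∩ ∁ ⁅ y ⁆ ∣ + d   ≤⟨ +-monoˡ-≤ d (x∈p⇒∣p∩∁⁅x⁆∣<∣p∣ y∈) ⟩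
  ∣ P ∩ unused g (t + d) ∣ + d                   ≤⟨ ∣∩unused∣-shrinks P t d g∈′ ⟩
  ∣ P ∩ unused g t ∣                             ∎
  where
  open ≤-Reasoning
  y = g (t + d)
  y∈ = g∈ (t + d) (m≤m+n t d) (+-monoʳ-< t ≤-refl)
  g∈′ = λ j t≤j j<t+d → g∈ j t≤j (subst (j <_) (sym (+-suc t d)) (m<n⇒m<1+n j<t+d))

∣options∣≤n∸k : ∀ {R : Rule n} (R′ : Rule n) {g m k} → Follows R g m → k ≤ m → ∣ options R′ g k ∣ ≤ n ∸ k
∣options∣≤n∸k {n} {R} R′ {g} {k = k} follows k≤m = m+n≤o⇒m≤o∸n _ (begin
  ∣ R′ g k ∩ unused g k ∣ + k  ≤⟨ +-monoˡ-≤ k (∣p∩q∣≤∣q∣ (R′ g k) (unused g k)) ⟩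
  ∣ unused g k ∣ + k           ≡⟨ cong (λ p → ∣ p ∣ + k) (∩-identityˡ (unused g k)) ⟨
  ∣ ⊤ ∩ unused g k ∣ + k       ≤⟨ ∣∩unused∣-shrinks (⊤ {n}) 0 k unused-before-k ⟩
  ∣ ⊤ {n} ∩ ⊤ ∣                ≤⟨ ∣p∩q∣≤∣p∣ (⊤ {n}) ⊤ ⟩
  ∣ ⊤ {n} ∣                    ≡⟨ ∣⊤∣≡n n ⟩
  n                            ∎)
  where
  open ≤-Reasoning
  unused-before-k = λ j _ j<k → x∈p∩q⁺ (∈⊤ , proj₂ (x∈p∩q⁻ (R g j) _ (follows j (<-≤-trans j<k k≤m))))

module _ (R : Rule n) {c : ℕ → ℕ} {g : ℕ → Fin n} {m : ℕ}
         (follows : Follows R g m) (bounded : ∀ k → k < m → ∣ options R g k ∣ ≤ c k) where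

  private
    digit-< : ∀ k → k < m → rank (options R g k) (g k) < c k
    digit-< k k<m = <-≤-trans (rank-< (follows k k<m)) (bounded k k<m)

  seqCode-< : seqCode R c g m < ∏< c m
  seqCode-< = radix-< m digit-<

  seqCode-injective : ∀ (R′ : Rule n) {g′} → Follows R′ g′ m → (∀ k → k < m → ∣ options R′ g′ k ∣ ≤ c k) →
                      (∀ k → k < m → (∀ j → j < k → g j ≡ g′ j) → R g k ≡ R′ g′ k) →
                      seqCode R c g m ≡ seqCode R′ c g′ m → ∀ k → k < m → g k ≡ g′ k
  seqCode-injective R′ {g′} follows′ bounded′ R≡R′ e k k<m = agree (suc k) k<m k ≤-refl
    where
    same-digit : ∀ k → k < m → rank (options R g k) (g k) ≡ rank (options R′ g′ k) (g′ k)
    same-digit = radix-injective m digit-< (λ k k<m → <-≤-trans (rank-< (follows′ k k<m)) (bounded′ k k<m)) e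
    agree : ∀ k → k ≤ m → ∀ j → j < k → g j ≡ g′ j
    agree (suc k) k<m j j<1+k with m≤n⇒m<n∨m≡n (≤-pred j<1+k)
    ... | inj₁ j<k  = agree k (<⇒≤ k<m) j j<k
    ... | inj₂ refl = rank-injective (follows k k<m) (subst (g′ k ∈_) (sym same-options) (follows′ k k<m))
                        (trans (same-digit k k<m) (cong (λ p → rank p (g′ k)) (sym same-options)))
      where
      same-options : options R g k ≡ options R′ g′ k
      same-options = cong₂ _∩_ (R≡R′ k k<m (agree k (<⇒≤ k<m))) (unused-cong k (agree k (<⇒≤ k<m)))

-- The order of the wreath product Sₐ ≀ S_b

[i*a+j]%a≡j : ∀ i {a j} .{{_ : NonZero a}} → j < a → (i * a + j) % a ≡ j
[i*a+j]%a≡j i {a} {j} j<a = trans (cong (_% a) (+-comm (i * a) j)) (trans ([m+kn]%n≡m%n j i a) (m<n⇒m%n≡m j<a))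

[1+B]*a≤B*[a∸1]*4 : ∀ {a B} → 2 ≤ a → 1 ≤ B → suc B * a ≤ B * (a ∸ 1) * 4
[1+B]*a≤B*[a∸1]*4 {suc (suc a′)} {suc b′} (s≤s (s≤s _)) (s≤s _) =
  subst (suc (suc b′) * suc (suc a′) ≤_) (sym (expand a′ b′)) (m≤m+n _ (3 * (b′ * a′) + 2 * a′ + 2 * b′))
  where
  expand : ∀ a′ b′ → suc b′ * suc a′ * 4 ≡ suc (suc b′) * suc (suc a′) + (3 * (b′ * a′) + 2 * a′ + 2 * b′)
  expand = solve-∀

module _ (N a : ℕ) .{{_ : NonZero a}} where

  -- A position starting a block of size a may take any unused value; any other position must
  -- stay in the block already entered. So ∏< choices N = (a!)^(N/a) · (N/a)! when a ∣ N.
  choices : ℕ → ℕ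
  choices k with k % a
  ... | zero  = N ∸ k
  ... | suc j = a ∸ suc j

  private
    blockChoices blockFalling : ℕ → ℕ
    blockChoices i = ∏< (λ j → choices (i * a + j)) a
    blockFalling i = ∏< (λ j → N ∸ (i * a + j)) a

    weight : ℕ → ℕ
    weight zero    = 1
    weight (suc _) = 2

    ∏<-weight : ∀ m .{{_ : NonZero m}} → ∏< weight m ≡ 2 ^ (m ∸ 1)
    ∏<-weight (suc zero)    = refl
    ∏<-weight (suc (suc m)) = cong (2 *_) (∏<-weight (suc m))

    ∏<-block : ∀ c B → ∏< c (suc B * a) ≡ ∏< (λ j → c (B * a + j)) a * ∏< c (B * a)
    ∏<-block c B = trans (cong (∏< c) (+-comm a (B * a))) (∏<-+ c (B * a) a)

    choices-≤ : ∀ i j → j < a → i * a + a ≤ N → choices (i * a + j) ≤ N ∸ (i * a + j)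
    choices-≤ i j j<a _ with (i * a + j) % a | [i*a+j]%a≡j i j<a
    choices-≤ i zero    _ _      | .0       | refl = ≤-refl
    choices-≤ i (suc j) _ ia+a≤N | .(suc j) | refl = begin
      a ∸ suc j                      ≡⟨ [m+n]∸[m+o]≡n∸o (i * a) a (suc j) ⟨
      (i * a + a) ∸ (i * a + suc j)  ≤⟨ ∸-monoˡ-≤ (i * a + suc j) ia+a≤N ⟩
      N ∸ (i * a + suc j)            ∎
      where open ≤-Reasoning

    weighted-choices-≤ : ∀ i j → j < a → i * a + (a + a) ≤ N → choices (i * a + j) * weight j ≤ N ∸ (i * a + j)
    weighted-choices-≤ i j j<a _ with (i * a + j) % a | [i*a+j]%a≡j i j<a
    weighted-choices-≤ i zero    _   _       | .0       | refl = ≤-reflexive (*-identityʳ _)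
    weighted-choices-≤ i (suc j) j<a ia+2a≤N | .(suc j) | refl = begin
      (a ∸ suc j) * 2                      ≡⟨ *-comm (a ∸ suc j) 2 ⟩
      2 * (a ∸ suc j)                      ≡⟨ cong ((a ∸ suc j) +_) (+-identityʳ (a ∸ suc j)) ⟩
      (a ∸ suc j) + (a ∸ suc j)            ≤⟨ +-monoʳ-≤ (a ∸ suc j) (m∸n≤m a (suc j)) ⟩
      (a ∸ suc j) + a                      ≡⟨ +-∸-comm a (<⇒≤ j<a) ⟨
      (a + a) ∸ suc j                      ≡⟨ [m+n]∸[m+o]≡n∸o (i * a) (a + a) (suc j) ⟨
      (i * a + (a + a)) ∸ (i * a + suc j)  ≤⟨ ∸-monoˡ-≤ (i * a + suc j) ia+2a≤N ⟩
      N ∸ (i * a + suc j)                  ∎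
      where open ≤-Reasoning

    last-block-≤ : ∀ i → i * a + a ≤ N → blockChoices i ≤ blockFalling i
    last-block-≤ i ia+a≤N = ∏<-mono-≤ a (λ j j<a → choices-≤ i j j<a ia+a≤N)

    inner-block-≤ : ∀ i → i * a + (a + a) ≤ N → blockChoices i * 2 ^ (a ∸ 1) ≤ blockFalling i
    inner-block-≤ i ia+2a≤N = begin
      blockChoices i * 2 ^ (a ∸ 1)                      ≡⟨ cong (blockChoices i *_) (∏<-weight a) ⟨
      blockChoices i * ∏< weight a                      ≡⟨ ∏<-* (λ j → choices (i * a + j)) weight a ⟨
      ∏< (λ j → choices (i * a + j) * weight j) a       ≤⟨ ∏<-mono-≤ a (λ j j<a → weighted-choices-≤ i j j<a ia+2a≤N) ⟩
      blockFalling i                                    ∎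
      where open ≤-Reasoning

    initial-blocks-≤ : ∀ B → B * a + a ≤ N → ∏< choices (B * a) * 2 ^ (B * (a ∸ 1)) ≤ ∏< (N ∸_) (B * a)
    initial-blocks-≤ zero    _         = ≤-refl
    initial-blocks-≤ (suc B) 1+B·a+a≤N = begin
      ∏< choices (suc B * a) * 2 ^ (suc B * (a ∸ 1))
        ≡⟨ cong₂ _*_ (∏<-block choices B) (^-distribˡ-+-* 2 (a ∸ 1) (B * (a ∸ 1))) ⟩
      (blockChoices B * ∏< choices (B * a)) * (2 ^ (a ∸ 1) * 2 ^ (B * (a ∸ 1)))
        ≡⟨ interchange (blockChoices B) _ _ _ ⟩
      (blockChoices B * 2 ^ (a ∸ 1)) * (∏< choices (B * a) * 2 ^ (B * (a ∸ 1)))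
        ≤⟨ *-mono-≤ (inner-block-≤ B B·a+2a≤N) (initial-blocks-≤ B B·a+a≤N) ⟩
      blockFalling B * ∏< (N ∸_) (B * a)
        ≡⟨ ∏<-block (N ∸_) B ⟨
      ∏< (N ∸_) (suc B * a) ∎
      where
      open ≤-Reasoning
      B·a+2a≤N : B * a + (a + a) ≤ N
      B·a+2a≤N = subst (_≤ N) (trans (cong (_+ a) (+-comm a (B * a))) (+-assoc (B * a) a a)) 1+B·a+a≤N
      B·a+a≤N : B * a + a ≤ N
      B·a+a≤N = ≤-trans (m≤m+n (B * a + a) a) (subst (_≤ N) (sym (+-assoc (B * a) a a)) B·a+2a≤N)

    all-blocks-≤ : ∀ B → N ≡ suc B * a → ∏< choices N * 2 ^ (B * (a ∸ 1)) ≤ N !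
    all-blocks-≤ B refl = begin
      ∏< choices N * 2 ^ (B * (a ∸ 1))
        ≡⟨ cong (_* 2 ^ (B * (a ∸ 1))) (∏<-block choices B) ⟩
      (blockChoices B * ∏< choices (B * a)) * 2 ^ (B * (a ∸ 1))
        ≡⟨ *-assoc (blockChoices B) _ _ ⟩
      blockChoices B * (∏< choices (B * a) * 2 ^ (B * (a ∸ 1)))
        ≤⟨ *-mono-≤ (last-block-≤ B B·a+a≤N) (initial-blocks-≤ B B·a+a≤N) ⟩
      blockFalling B * ∏< (N ∸_) (B * a)
        ≡⟨ ∏<-block (N ∸_) B ⟨
      ∏< (N ∸_) N
        ≡⟨ ∏<-factorial N ⟩
      N ! ∎
      where
      open ≤-Reasoning
      B·a+a≤N : B * a + a ≤ N
      B·a+a≤N = ≤-reflexive (+-comm (B * a) a)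

  wreath-bound : ∀ b → N ≡ b * a → 2 ≤ a → 2 ≤ b → ∏< choices N ^ 4 * 2 ^ N ≤ (N !) ^ 4
  wreath-bound (suc B) N≡b·a 2≤a (s≤s 1≤B) = begin
    W ^ 4 * 2 ^ N            ≤⟨ *-monoʳ-≤ (W ^ 4) (^-monoʳ-≤ 2 N≤e*4) ⟩
    W ^ 4 * 2 ^ (e * 4)      ≡⟨ cong (W ^ 4 *_) (^-*-assoc 2 e 4) ⟨
    W ^ 4 * (2 ^ e) ^ 4      ≡⟨ ^-distribʳ-* W (2 ^ e) 4 ⟨
    (W * 2 ^ e) ^ 4          ≤⟨ ^-monoˡ-≤ 4 (all-blocks-≤ B N≡b·a) ⟩
    (N !) ^ 4                ∎
    where
    open ≤-Reasoning
    W = ∏< choices N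
    e = B * (a ∸ 1)
    N≤e*4 : N ≤ e * 4
    N≤e*4 = subst (_≤ e * 4) (sym N≡b·a) ([1+B]*a≤B*[a∸1]*4 2≤a 1≤B)

^4-lift : ∀ {w F N} l → w ^ 4 * 2 ^ N ≤ F ^ 4 → (w ^ l * F) ^ 4 * 2 ^ (N * l) ≤ (F ^ suc l) ^ 4
^4-lift {w} {F} {N} zero _ = ≤-reflexive (begin
  (1 * F) ^ 4 * 2 ^ (N * 0)  ≡⟨ cong (λ e → (1 * F) ^ 4 * 2 ^ e) (*-zeroʳ N) ⟩
  (1 * F) ^ 4 * 1            ≡⟨ *-identityʳ _ ⟩
  (1 * F) ^ 4                ≡⟨ cong (_^ 4) (trans (*-identityˡ F) (sym (*-identityʳ F))) ⟩
  (F * 1) ^ 4                ∎)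
  where open ≡-Reasoning
^4-lift {w} {F} {N} (suc l) w⁴2ᴺ≤F⁴ = begin
  (w * w ^ l * F) ^ 4 * 2 ^ (N * suc l)              ≡⟨ cong (λ e → (w * w ^ l * F) ^ 4 * 2 ^ e) (*-suc N l) ⟩
  (w * w ^ l * F) ^ 4 * 2 ^ (N + N * l)              ≡⟨ cong ((w * w ^ l * F) ^ 4 *_) (^-distribˡ-+-* 2 N (N * l)) ⟩
  (w * w ^ l * F) ^ 4 * (2 ^ N * 2 ^ (N * l))        ≡⟨ cong (λ x → x ^ 4 * (2 ^ N * 2 ^ (N * l))) (*-assoc w (w ^ l) F) ⟩
  (w * (w ^ l * F)) ^ 4 * (2 ^ N * 2 ^ (N * l))      ≡⟨ cong (_* (2 ^ N * 2 ^ (N * l))) (^-distribʳ-* w (w ^ l * F) 4) ⟩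
  (w ^ 4 * (w ^ l * F) ^ 4) * (2 ^ N * 2 ^ (N * l))  ≡⟨ interchange (w ^ 4) ((w ^ l * F) ^ 4) (2 ^ N) (2 ^ (N * l)) ⟩
  (w ^ 4 * 2 ^ N) * ((w ^ l * F) ^ 4 * 2 ^ (N * l))  ≤⟨ *-mono-≤ w⁴2ᴺ≤F⁴ (^4-lift {w} {F} {N} l w⁴2ᴺ≤F⁴) ⟩
  F ^ 4 * (F ^ suc l) ^ 4                            ≡⟨ ^-distribʳ-* F (F ^ suc l) 4 ⟨
  (F ^ suc (suc l)) ^ 4                              ∎
  where
  open ≤-Reasoning

-- Partitions with blocks of equal size

block : (Fin n → Fin n) → Fin n → Subset n
block f x = ⟦ (λ y → f y Fin.≟ f x) ⟧

SameBlocks : (f f′ : Fin n → Fin n) → Set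
SameBlocks f f′ = ∀ x y → f x ≡ f y ⇔ f′ x ≡ f′ y

module _ (f : Fin n → Fin n) {x y : Fin n} where

  ∈block⁺ : f y ≡ f x → y ∈ block f x
  ∈block⁺ = ∈⟦⟧⁺ (λ z → f z Fin.≟ f x)

  ∈block⁻ : y ∈ block f x → f y ≡ f x
  ∈block⁻ = ∈⟦⟧⁻ (λ z → f z Fin.≟ f x)

  block-cong : f x ≡ f y → block f x ≡ block f y
  block-cong e = cong (λ c → ⟦ (λ z → f z Fin.≟ c) ⟧) e

module _ (f : Fin n → Fin n) {x y : Fin n} where

  2≤∣block∣ : x ≢ y → f x ≡ f y → 2 ≤ ∣ block f x ∣
  2≤∣block∣ x≢y fx≡fy = subst (_< ∣ block f x ∣) (∣⁅x⁆∣≡1 x) (p⊂q⇒∣p∣<∣q∣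
    ( (λ z∈⁅x⁆ → ∈block⁺ f (cong f (x∈⁅y⁆⇒x≡y x z∈⁅x⁆)))
    , y , ∈block⁺ f (sym fx≡fy) , x≢y⇒x∉⁅y⁆ (x≢y ∘ sym)))

  ∣block∣<n : f x ≢ f y → ∣ block f x ∣ < n
  ∣block∣<n fx≢fy = subst (∣ block f x ∣ <_) (∣⊤∣≡n n)
    (p⊂q⇒∣p∣<∣q∣ ((λ _ → ∈⊤) , y , ∈⊤ , λ y∈ → fx≢fy (sym (∈block⁻ f y∈))))

block-nonempty : ∀ (f : Fin n → Fin n) x → 0 < ∣ block f x ∣
block-nonempty f x = ≤-<-trans z≤n (rank-< (∈block⁺ f refl))

block-≡ : ∀ {f f′ : Fin n → Fin n} → SameBlocks f f′ → ∀ x → block f x ≡ block f′ x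
block-≡ {f = f} {f′} f≈f′ x = tabulate-cong (λ y → does-⇔ (f≈f′ y x) (f y Fin.≟ f x) (f′ y Fin.≟ f′ x))

module BlockEnumeration {n} (f : Fin n → Fin n) (a : ℕ) .{{_ : NonZero a}}
                        (size : ∀ x → ∣ block f x ∣ ≡ a) where

  head : Fin n → Fin n
  head x = proj₁ (rank-surjective (block f x) (block-nonempty f x))

  head-least : ∀ x → IsLeast (block f x) (head x)
  head-least x = proj₂ (rank-surjective (block f x) (block-nonempty f x))

  head-cong : ∀ {x y} → f x ≡ f y → head x ≡ head y
  head-cong {x} {y} e = least-unique (head-least x)
    (subst (λ p → IsLeast p (head y)) (block-cong f (sym e)) (head-least y))

  heads : Subset n
  heads = ⟦ (λ y → head y Fin.≟ y) ⟧

  head-∈heads : ∀ x → head x ∈ heads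
  head-∈heads x = ∈⟦⟧⁺ (λ y → head y Fin.≟ y) (head-cong (∈block⁻ f (proj₁ (head-least x))))

  blockIndex : Fin n → ℕ
  blockIndex x = rank heads (head x)

  same-block⇔ : ∀ {x y} → f x ≡ f y ⇔ blockIndex x ≡ blockIndex y
  same-block⇔ {x} {y} = mk⇔ (cong (rank heads) ∘ head-cong) λ e → begin
    f x         ≡⟨ ∈block⁻ f (proj₁ (head-least x)) ⟨
    f (head x)  ≡⟨ cong f (rank-injective (head-∈heads x) (head-∈heads y) e) ⟩
    f (head y)  ≡⟨ ∈block⁻ f (proj₁ (head-least y)) ⟩
    f y         ∎
    where open ≡-Reasoning

  b : ℕ
  b = ∣ heads ∣

  pos : Fin n → ℕ
  pos x = rank (block f x) x + blockIndex x * a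

  private
    rank-<a : ∀ x → rank (block f x) x < a
    rank-<a x = subst (rank (block f x) x <_) (size x) (rank-< (∈block⁺ f refl))

  pos-< : ∀ x → pos x < b * a
  pos-< x = +*-< (rank-<a x) (rank-< (head-∈heads x))

  pos-injective : ∀ {x y} → pos x ≡ pos y → x ≡ y
  pos-injective {x} {y} e = rank-injective (∈block⁺ f refl) (∈block⁺ f (sym fx≡fy))
    (trans (proj₁ split) (cong (λ p → rank p y) (block-cong f (sym fx≡fy))))
    where
    split = +*-injective {d = blockIndex x} {blockIndex y} (rank-<a x) (rank-<a y) e
    fx≡fy = Equivalence.from same-block⇔ (proj₂ split)

  pos-surjective : ∀ {k} → k < b * a → ∃ λ x → pos x ≡ k
  pos-surjective {k} k<b·a =
    let h , h∈heads , rank-h = rank-surjective heads (m<n*o⇒m/o<n k<b·a)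
        x , x∈block , rank-x = rank-surjective (block f h) (subst (k % a <_) (sym (size h)) (m%n<n k a))
        fx≡fh = ∈block⁻ f x∈block
        head-x≡h = trans (head-cong fx≡fh) (∈⟦⟧⁻ (λ y → head y Fin.≟ y) h∈heads)
    in x , (begin
      rank (block f x) x + rank heads (head x) * a
        ≡⟨ cong₂ (λ p h → rank p x + rank heads h * a) (block-cong f fx≡fh) head-x≡h ⟩
      rank (block f h) x + rank heads h * a
        ≡⟨ cong₂ (λ r i → r + i * a) rank-x rank-h ⟩
      k % a + (k / a) * a
        ≡⟨ m≡m%n+[m/n]*n k a ⟨
      k ∎)
    where open ≡-Reasoning

  n≡b*a : n ≡ b * a
  n≡b*a = ≤-antisym (injective-bounded⇒≤ pos pos-< pos-injective)
    (Fin.injective⇒≤ {f = λ i → proj₁ (pos-surjective (Fin.toℕ<n i))}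
       (λ {i} {j} e → Fin.toℕ-injective (trans (sym (proj₂ (pos-surjective (Fin.toℕ<n i))))
                         (trans (cong pos e) (proj₂ (pos-surjective (Fin.toℕ<n j)))))))

  blockIndex≡pos/a : ∀ x → blockIndex x ≡ pos x / a
  blockIndex≡pos/a x =
    proj₂ (+*-injective {d = blockIndex x} (rank-<a x) (m%n<n (pos x) a) (m≡m%n+[m/n]*n (pos x) a))

  -- x₀ is a junk value for positions beyond n.
  module _ (x₀ : Fin n) where

    elementAt : ℕ → Fin n
    elementAt k with k <? b * a
    ... | yes k<b·a = proj₁ (pos-surjective k<b·a)
    ... | no  _     = x₀

    pos-elementAt : ∀ {k} → k < n → pos (elementAt k) ≡ k
    pos-elementAt {k} k<n with k <? b * a
    ... | yes k<b·a = proj₂ (pos-surjective k<b·a)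
    ... | no  k≮b·a = ⊥-elim (k≮b·a (subst (k <_) n≡b*a k<n))

    pos-<n : ∀ x → pos x < n
    pos-<n x = subst (pos x <_) (sym n≡b*a) (pos-< x)

    elementAt-pos : ∀ x → elementAt (pos x) ≡ x
    elementAt-pos x = pos-injective (pos-elementAt (pos-<n x))

    same-block-at⇔ : ∀ {k k′} → k < n → k′ < n → f (elementAt k) ≡ f (elementAt k′) ⇔ k / a ≡ k′ / a
    same-block-at⇔ {k} {k′} k<n k′<n = mk⇔
      (λ e → trans (index≡ k<n) (trans (Equivalence.to same-block⇔ e) (sym (index≡ k′<n))))
      (λ q → Equivalence.from same-block⇔ (trans (sym (index≡ k<n)) (trans q (index≡ k′<n))))
      where
      index≡ : ∀ {k} → k < n → k / a ≡ blockIndex (elementAt k)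
      index≡ {k} k<n = trans (cong (_/ a) (sym (pos-elementAt k<n))) (sym (blockIndex≡pos/a (elementAt k)))

module _ {f f′ : Fin n → Fin n} {a} .{{_ : NonZero a}}
         {size : ∀ x → ∣ block f x ∣ ≡ a} {size′ : ∀ x → ∣ block f′ x ∣ ≡ a}
         (f≈f′ : SameBlocks f f′) where

  private
    module E  = BlockEnumeration f  a size
    module E′ = BlockEnumeration f′ a size′

    head-≡ : ∀ x → E.head x ≡ E′.head x
    head-≡ x = least-unique (E.head-least x)
      (subst (λ p → IsLeast p (E′.head x)) (sym (block-≡ f≈f′ x)) (E′.head-least x))

    pos-≡ : ∀ x → E.pos x ≡ E′.pos x
    pos-≡ x = cong₂ (λ p i → rank p x + i * a) (block-≡ f≈f′ x)
      (cong₂ rank (tabulate-cong (λ y → cong (λ h → does (h Fin.≟ y)) (head-≡ y))) (head-≡ x))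

  elementAt-cong : ∀ x₀ {k} → k < n → E.elementAt x₀ k ≡ E′.elementAt x₀ k
  elementAt-cong x₀ k<n =
    E.pos-injective (trans (E.pos-elementAt x₀ k<n) (sym (trans (pos-≡ _) (E′.pos-elementAt x₀ k<n))))

⟨$⟩ʳ-injective : ∀ (π : Permutation′ n) → Injective _≡_ _≡_ (π ⟨$⟩ʳ_)
⟨$⟩ʳ-injective π e = trans (sym (inverseˡ π)) (trans (cong (π ⟨$⟩ˡ_) e) (inverseˡ π))

⟨$⟩ˡ-injective : ∀ (π : Permutation′ n) → Injective _≡_ _≡_ (π ⟨$⟩ˡ_)
⟨$⟩ˡ-injective π e = trans (sym (inverseʳ π)) (trans (cong (π ⟨$⟩ʳ_) e) (inverseʳ π))

act-injective : ∀ {l} (σ : Tuple l n) w → Injective _≡_ _≡_ (act σ w)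
act-injective σ List.[]                 e = e
act-injective σ ((i , true)  List.∷ w) e = act-injective σ w (⟨$⟩ʳ-injective (σ i) e)
act-injective σ ((i , false) List.∷ w) e = act-injective σ w (⟨$⟩ˡ-injective (σ i) e)

module _ {l} {σ : Tuple l n} {f : Fin n → Fin n} (preserves : Preserves σ f) where

  preserves-generator : ∀ i {x y} → f x ≡ f y → f (σ i ⟨$⟩ʳ x) ≡ f (σ i ⟨$⟩ʳ y)
  preserves-generator i = preserves List.[ i , true ] _ _

  reflects-generator : ∀ i {x y} → f (σ i ⟨$⟩ʳ x) ≡ f (σ i ⟨$⟩ʳ y) → f x ≡ f y
  reflects-generator i e =
    subst₂ (λ u v → f u ≡ f v) (inverseˡ (σ i)) (inverseˡ (σ i)) (preserves List.[ i , false ] _ _ e)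

  ∣block∣-≤ : IsTransitive σ → ∀ x y → ∣ block f x ∣ ≤ ∣ block f y ∣
  ∣block∣-≤ transitive x y = ∣p∣≤∣q∣-by-injection (act σ w) (act-injective σ w)
    (λ z∈ → ∈block⁺ f (trans (preserves w _ x (∈block⁻ f z∈)) (cong f wx≡y)))
    where
    w = proj₁ (transitive x y)
    wx≡y = proj₂ (transitive x y)

-- Coding tuples that preserve a partition

module _ {a : ℕ} .{{_ : NonZero a}} where

  blockStart+rem : ∀ {k r} → k % a ≡ suc r → k / a * a + suc r ≡ k
  blockStart+rem {k} e = trans (+-comm _ (suc _)) (trans (cong (_+ k / a * a) (sym e)) (sym (m≡m%n+[m/n]*n k a)))

  same-quotient : ∀ {j k} → k / a * a ≤ j → j ≤ k → j / a ≡ k / a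
  same-quotient {j} {k} s≤j j≤k =
    ≤-antisym (/-monoˡ-≤ a j≤k) (subst (_≤ j / a) (m*n/n≡m (k / a) a) (/-monoˡ-≤ a s≤j))

anyRule : Rule n
anyRule _ _ = ⊤

blockRule : (Fin n → Fin n) → (a : ℕ) .{{_ : NonZero a}} → Rule n
blockRule f a g k with k % a
... | zero  = ⊤
... | suc _ = block f (g (k / a * a))

blockRule-cong : ∀ {f f′ : Fin n → Fin n} {a} .{{_ : NonZero a}} {g g′ k} → SameBlocks f f′ →
                 (∀ j → j < k → g j ≡ g′ j) → blockRule f a g k ≡ blockRule f′ a g′ k
blockRule-cong {f′ = f′} {a} {g} {k = k} f≈f′ g≡g′ with k % a in eq
... | zero  = refl
... | suc r = trans (block-≡ f≈f′ (g (k / a * a)))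
                    (cong (block f′) (g≡g′ _ (subst (k / a * a <_) (blockStart+rem eq) (m<m+n _ (s≤s z≤n)))))

module Coding {l′} (σ : Tuple (suc l′) n) {f : Fin n → Fin n} (preserves : Preserves σ f)
              (a : ℕ) .{{_ : NonZero a}} (size : ∀ x → ∣ block f x ∣ ≡ a) (x₀ : Fin n) where

  open BlockEnumeration f a size

  images : Fin (suc l′) → ℕ → Fin n
  images i k = σ i ⟨$⟩ʳ elementAt x₀ k

  images-onto : ∀ i x → ∃ λ k → k < n × images i k ≡ x
  images-onto i x = pos (σ i ⟨$⟩ˡ x) , pos-<n x₀ _ ,
    trans (cong (σ i ⟨$⟩ʳ_) (elementAt-pos x₀ (σ i ⟨$⟩ˡ x))) (inverseʳ (σ i))

  images-same-block⇔ : ∀ i {k k′} → k < n → k′ < n → f (images i k) ≡ f (images i k′) ⇔ k / a ≡ k′ / a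
  images-same-block⇔ i k<n k′<n =
    ⇔.trans (mk⇔ (reflects-generator preserves i) (preserves-generator preserves i)) (same-block-at⇔ x₀ k<n k′<n)

  images-fresh : ∀ i {k} → k < n → images i k ∈ unused (images i) k
  images-fresh i {k} k<n = ∈unused⁺ k λ j j<k e → <⇒≢ j<k
    (trans (sym (pos-elementAt x₀ (<-trans j<k k<n)))
           (trans (cong pos (⟨$⟩ʳ-injective (σ i) e)) (pos-elementAt x₀ k<n)))

  private
    images-in-block : ∀ i {j k} → k < n → k / a * a ≤ j → j ≤ k → images i j ∈ block f (images i (k / a * a))
    images-in-block i k<n s≤j j≤k = ∈block⁺ f (Equivalence.from
      (images-same-block⇔ i (≤-<-trans j≤k k<n) (≤-<-trans (≤-trans s≤j j≤k) k<n))
      (trans (same-quotient s≤j j≤k) (sym (m*n/n≡m _ a))))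

  follows-any : ∀ i → Follows anyRule (images i) n
  follows-any i k k<n = x∈p∩q⁺ (∈⊤ , images-fresh i k<n)

  follows-block : ∀ i → Follows (blockRule f a) (images i) n
  follows-block i k k<n with k % a in eq
  ... | zero  = x∈p∩q⁺ (∈⊤ , images-fresh i k<n)
  ... | suc r = x∈p∩q⁺ (images-in-block i k<n (subst (k / a * a ≤_) (blockStart+rem eq) (m≤m+n _ _)) ≤-refl ,
                        images-fresh i k<n)

  bounded-any : ∀ i k → k < n → ∣ options anyRule (images i) k ∣ ≤ n ∸ k
  bounded-any i k k<n = ∣options∣≤n∸k {R = anyRule} anyRule (follows-any i) (<⇒≤ k<n)

  bounded-block : ∀ i k → k < n → ∣ options (blockRule f a) (images i) k ∣ ≤ choices n a k
  bounded-block i k k<n with k % a in eq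
  ... | zero  = ∣options∣≤n∸k {R = blockRule f a} anyRule (follows-block i) (<⇒≤ k<n)
  ... | suc r = m+n≤o⇒m≤o∸n _ (begin
    ∣ B ∩ unused (images i) k ∣ + suc r            ≡⟨ cong (λ t → ∣ B ∩ unused (images i) t ∣ + suc r) k≡s+1+r ⟩
    ∣ B ∩ unused (images i) (s + suc r) ∣ + suc r  ≤⟨ ∣∩unused∣-shrinks B s (suc r) earlier-in-block ⟩
    ∣ B ∩ unused (images i) s ∣                    ≤⟨ ∣p∩q∣≤∣p∣ B _ ⟩
    ∣ B ∣                                          ≡⟨ size _ ⟩
    a                                              ∎)
    where
    open ≤-Reasoning
    s = k / a * a
    B = block f (images i s)
    k≡s+1+r = sym (blockStart+rem eq)
    earlier-in-block : ∀ j → s ≤ j → j < s + suc r → images i j ∈ B ∩ unused (images i) j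
    earlier-in-block j s≤j j<s+1+r = x∈p∩q⁺ (images-in-block i k<n s≤j (<⇒≤ j<k) , images-fresh i (<-trans j<k k<n))
      where j<k = subst (j <_) (blockStart+rem eq) j<s+1+r

  firstCode : ℕ
  firstCode = seqCode anyRule (n ∸_) (images fzero) n

  laterCode : Fin l′ → ℕ
  laterCode i = seqCode (blockRule f a) (choices n a) (images (fsuc i)) n

  tupleCode : ℕ
  tupleCode = firstCode + radixᶠ (∏< (choices n a) n) laterCode * n !

  firstCode-< : firstCode < n !
  firstCode-< = subst (firstCode <_) (∏<-factorial n) (seqCode-< anyRule (follows-any fzero) (bounded-any fzero))

  laterCode-< : ∀ i → laterCode i < ∏< (choices n a) n
  laterCode-< i = seqCode-< (blockRule f a) (follows-block (fsuc i)) (bounded-block (fsuc i))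

  tupleCode-< : tupleCode < ∏< (choices n a) n ^ l′ * n !
  tupleCode-< = +*-< firstCode-< (radixᶠ-< laterCode laterCode-<)

module _ {l′} {σ σ′ : Tuple (suc l′) n} {f f′ : Fin n → Fin n}
         {preserves : Preserves σ f} {preserves′ : Preserves σ′ f′}
         {a} .{{_ : NonZero a}} {size : ∀ x → ∣ block f x ∣ ≡ a} {size′ : ∀ x → ∣ block f′ x ∣ ≡ a}
         (x₀ : Fin n) where

  private
    module C  = Coding σ  preserves  a size  x₀
    module C′ = Coding σ′ preserves′ a size′ x₀
    module E  = BlockEnumeration f a size

  tupleCode-injective : C.tupleCode ≡ C′.tupleCode → ∀ i x → σ i ⟨$⟩ʳ x ≡ σ′ i ⟨$⟩ʳ x
  tupleCode-injective e i x = begin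
    σ i ⟨$⟩ʳ x                          ≡⟨ cong (σ i ⟨$⟩ʳ_) (E.elementAt-pos x₀ x) ⟨
    C.images i (E.pos x)                ≡⟨ same-images i (E.pos-<n x₀ x) ⟩
    C′.images i (E.pos x)               ≡⟨ cong (σ′ i ⟨$⟩ʳ_) (elementAt-cong same-blocks x₀ (E.pos-<n x₀ x)) ⟨
    σ′ i ⟨$⟩ʳ E.elementAt x₀ (E.pos x)  ≡⟨ cong (σ′ i ⟨$⟩ʳ_) (E.elementAt-pos x₀ x) ⟩
    σ′ i ⟨$⟩ʳ x                         ∎
    where
    open ≡-Reasoning
    split = +*-injective {d = radixᶠ _ C.laterCode} {radixᶠ _ C′.laterCode} C.firstCode-< C′.firstCode-< e

    same-first-images : ∀ k → k < n → C.images fzero k ≡ C′.images fzero k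
    same-first-images = seqCode-injective anyRule (C.follows-any fzero) (C.bounded-any fzero)
      anyRule (C′.follows-any fzero) (C′.bounded-any fzero) (λ _ _ _ → refl) (proj₁ split)

    -- The images of the first generator list the blocks of f, and likewise of f′, one after the other.
    same-blocks : SameBlocks f f′
    same-blocks x y =
      let k  , k<n  , k↦x  = C.images-onto fzero x
          k′ , k′<n , k′↦y = C.images-onto fzero y
      in ⇔.trans (subst₂ (λ u v → (f u ≡ f v) ⇔ (k / a ≡ k′ / a)) k↦x k′↦y (C.images-same-block⇔ fzero k<n k′<n))
           (⇔.sym (subst₂ (λ u v → (f′ u ≡ f′ v) ⇔ (k / a ≡ k′ / a))
              (trans (sym (same-first-images k k<n)) k↦x) (trans (sym (same-first-images k′ k′<n)) k′↦y)
              (C′.images-same-block⇔ fzero k<n k′<n)))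

    same-images : ∀ i {k} → k < n → C.images i k ≡ C′.images i k
    same-images fzero    = same-first-images _
    same-images (fsuc i) = seqCode-injective (blockRule f a) (C.follows-block (fsuc i)) (C.bounded-block (fsuc i))
      (blockRule f′ a) (C′.follows-block (fsuc i)) (C′.bounded-block (fsuc i)) (λ _ _ → blockRule-cong same-blocks)
      (radixᶠ-injective C.laterCode C′.laterCode C.laterCode-< C′.laterCode-< (proj₂ split) i) _

-- Block sizes are written suc a₁ so that, once identified, their NonZero instances coincide.
tupleCode-injective′ : ∀ {l′} {σ σ′ : Tuple (suc l′) n} {f f′ : Fin n → Fin n}
                       {preserves : Preserves σ f} {preserves′ : Preserves σ′ f′}
                       {a₁ a₁′} {size : ∀ x → ∣ block f x ∣ ≡ suc a₁} {size′ : ∀ x → ∣ block f′ x ∣ ≡ suc a₁′}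
                       (x₀ : Fin n) → a₁ ≡ a₁′ →
                       Coding.tupleCode σ preserves (suc a₁) size x₀ ≡
                       Coding.tupleCode σ′ preserves′ (suc a₁′) size′ x₀ →
                       ∀ i x → σ i ⟨$⟩ʳ x ≡ σ′ i ⟨$⟩ʳ x
tupleCode-injective′ {preserves = preserves} {preserves′} x₀ refl =
  tupleCode-injective {preserves = preserves} {preserves′} x₀

-- Counting transitive imprimitive tuples

module _ {A : Set} {R : A → A → Set} where

  AllPairs-lookup : ∀ {xs} → AllPairs R xs → ∀ {i j} → i Fin.< j → R (List.lookup xs i) (List.lookup xs j)
  AllPairs-lookup (r AllPairs.∷ rs) {fzero}  {fsuc j} _         = All.lookup r (∈-lookup j)
  AllPairs-lookup (r AllPairs.∷ rs) {fsuc i} {fsuc j} (s≤s i<j) = AllPairs-lookup rs i<j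

  length-≤-by-code : ∀ {P : A → Set} {xs B} (code : ∀ {x} → P x → ℕ) → (∀ {x} (px : P x) → code px < B) →
                     (∀ {x y} (px : P x) (py : P y) → code px ≡ code py → ¬ R x y) →
                     AllPairs R xs → All P xs → length xs ≤ B
  length-≤-by-code code code-< code-separates rs ps =
    injective-bounded⇒≤ (λ i → code (All.lookup ps (∈-lookup i))) (λ _ → code-< _) injective
    where
    injective : ∀ {i j} → code (All.lookup ps (∈-lookup i)) ≡ code (All.lookup ps (∈-lookup j)) → i ≡ j
    injective {i} {j} e with Fin.<-cmp i j
    ... | tri< i<j _ _ = ⊥-elim (code-separates _ _ e (AllPairs-lookup rs i<j))
    ... | tri≈ _ i≡j _ = i≡j
    ... | tri> _ _ j<i = ⊥-elim (code-separates _ _ (sym e) (AllPairs-lookup rs j<i))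

module _ (n l′ : ℕ) where

  -- Bounds the codes of tuples with blocks of size suc a₁; set to 0 unless 2 ≤ suc a₁ and
  -- suc a₁ ∣ n, the only case where wreath-bound applies.
  codeBound : ℕ → ℕ
  codeBound a₁ with 1 ≤? a₁ | suc a₁ ∣? n
  ... | yes _ | yes _ = ∏< (choices n (suc a₁)) n ^ l′ * n !
  ... | _     | _     = 0

  codeBound-attained : ∀ {a₁} → 1 ≤ a₁ → suc a₁ ∣ n → codeBound a₁ ≡ ∏< (choices n (suc a₁)) n ^ l′ * n !
  codeBound-attained {a₁} 1≤a₁ a∣n with 1 ≤? a₁ | suc a₁ ∣? n
  ... | yes _ | yes _ = refl
  ... | no ¬p | _     = ⊥-elim (¬p 1≤a₁)
  ... | yes _ | no ¬q = ⊥-elim (¬q a∣n)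

  codeBound-valid : ∀ {a₁} → suc a₁ < n → codeBound a₁ ^ 4 * 2 ^ (n * l′) ≤ ((n !) ^ suc l′) ^ 4
  codeBound-valid {a₁} a<n with 1 ≤? a₁ | suc a₁ ∣? n
  ... | yes 1≤a₁ | yes (divides (suc (suc q)) n≡q*a) =
    ^4-lift {N = n} l′ (wreath-bound n (suc a₁) (suc (suc q)) n≡q*a (s≤s 1≤a₁) (s≤s (s≤s z≤n)))
  ... | yes _ | yes (divides 0 n≡0)   = ⊥-elim (<⇒≱ a<n (subst (_≤ suc a₁) (sym n≡0) z≤n))
  ... | yes _ | yes (divides 1 n≡a+0) =
    ⊥-elim (<-irrefl refl (subst (suc a₁ <_) (trans n≡a+0 (+-identityʳ (suc a₁))) a<n))
  ... | no _  | _                     = z≤n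
  ... | yes _ | no _                  = z≤n

module TransImprimTuple {n′ l′} (σ : Tuple (suc l′) (suc n′)) (transImprim : TransImprim σ) where

  f : Fin (suc n′) → Fin (suc n′)
  f = proj₁ (proj₂ (proj₂ transImprim))

  preserves : Preserves σ f
  preserves = proj₁ (proj₂ (proj₂ (proj₂ transImprim)))

  a₁ : ℕ
  a₁ = ℕ.pred ∣ block f fzero ∣

  size : ∀ x → ∣ block f x ∣ ≡ suc a₁
  size x = trans (≤-antisym (∣block∣-≤ preserves (proj₁ transImprim) x fzero) (∣block∣-≤ preserves (proj₁ transImprim) fzero x))
                 (sym (suc-pred _ {{>-nonZero (block-nonempty f fzero)}}))

  1≤a₁ : 1 ≤ a₁
  1≤a₁ = let x , y , x≢y , fx≡fy = proj₁ (proj₂ (proj₂ (proj₂ (proj₂ transImprim))))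
         in ≤-pred (subst (2 ≤_) (size x) (2≤∣block∣ f x≢y fx≡fy))

  a₁<n′ : a₁ < n′
  a₁<n′ = let x , y , fx≢fy = proj₂ (proj₂ (proj₂ (proj₂ (proj₂ transImprim))))
          in ≤-pred (subst (_< suc n′) (size x) (∣block∣<n f fx≢fy))

  a∣n : suc a₁ ∣ suc n′
  a∣n = divides (BlockEnumeration.b f (suc a₁) size) (BlockEnumeration.n≡b*a f (suc a₁) size)

  code : ℕ
  code = a₁ + Coding.tupleCode σ preserves (suc a₁) size fzero * n′

  code-< : code < max< (codeBound (suc n′) l′) n′ * n′
  code-< = +*-< a₁<n′ (<-≤-trans (Coding.tupleCode-< σ preserves (suc a₁) size fzero)
                                 (≤-trans (≤-reflexive (sym (codeBound-attained (suc n′) l′ 1≤a₁ a∣n)))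
                                          (≤max< (codeBound (suc n′) l′) a₁<n′)))

code-separates : ∀ {n′ l′} {σ σ′ : Tuple (suc l′) (suc n′)} (transImprim : TransImprim σ) (transImprim′ : TransImprim σ′) →
                 TransImprimTuple.code σ transImprim ≡ TransImprimTuple.code σ′ transImprim′ → ¬ Distinct σ σ′
code-separates {σ = σ} {σ′} transImprim transImprim′ e σ≉σ′ =
  σ≉σ′ (tupleCode-injective′ {preserves = T.preserves} {T′.preserves} fzero (proj₁ split) (proj₂ split))
  where
  module T  = TransImprimTuple σ  transImprim
  module T′ = TransImprimTuple σ′ transImprim′
  split = +*-injective {d = Coding.tupleCode σ T.preserves (suc T.a₁) T.size fzero}
                       {Coding.tupleCode σ′ T′.preserves (suc T′.a₁) T′.size fzero} T.a₁<n′ T′.a₁<n′ e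

^4-count-bound : ∀ {x M m K X} .{{_ : NonZero X}} → x ≤ M * m → M ^ 4 * K ≤ X → x ^ 4 * K < suc m ^ 4 * X
^4-count-bound {x} {M} {m} {K} {X} x≤M*m M⁴K≤X = begin-strict
  x ^ 4 * K            ≤⟨ *-monoˡ-≤ K (^-monoˡ-≤ 4 x≤M*m) ⟩
  (M * m) ^ 4 * K      ≡⟨ cong (_* K) (^-distribʳ-* M m 4) ⟩
  M ^ 4 * m ^ 4 * K    ≡⟨ xy∙z≈y∙xz (M ^ 4) (m ^ 4) K ⟩
  m ^ 4 * (M ^ 4 * K)  ≤⟨ *-monoʳ-≤ (m ^ 4) M⁴K≤X ⟩
  m ^ 4 * X            <⟨ *-monoˡ-< X (^-monoˡ-< 4 (n<1+n m)) ⟩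
  suc m ^ 4 * X        ∎
  where
  open ≤-Reasoning

lemma3p10 : (n l : ℕ) → 1 ≤ n → 1 ≤ l →
    (L : List (Tuple l n)) → AllPairs Distinct L → All TransImprim L →
    (length L ^ 4) * (2 ^ (n * (l ∸ 1))) < (n ^ 4) * ((n !) ^ l) ^ 4
lemma3p10 (suc n′) (suc l′) _ _ L distinct transImprim =
  ^4-count-bound {M = max< (codeBound (suc n′) l′) n′} {n′} {{X≢0}}
    (length-≤-by-code (λ {σ} → TransImprimTuple.code σ) (λ {σ} → TransImprimTuple.code-< σ)
                      code-separates distinct transImprim)
    (max<-preserves (λ M → M ^ 4 * 2 ^ (suc n′ * l′) ≤ ((suc n′ !) ^ suc l′) ^ 4) (codeBound (suc n′) l′) n′ z≤n
                    (λ _ a₁<n′ → codeBound-valid (suc n′) l′ (s≤s a₁<n′)))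
  where
  X≢0 = m^n≢0 ((suc n′ !) ^ suc l′) 4 {{m^n≢0 (suc n′ !) (suc l′) {{suc n′ !≢0}}}}
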